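{- Let $b\ge3$ be odd, $n$ an even positive integer, and $K$ the transition matrix of the balanced carries chain on $\{ -\tfrac n2,\dots,\tfrac n2\}$. For $0\le j\le n$ and $-\tfrac n2\le i\le\tfrac n2$ let $u_j^n[i]$ be the coefficient of $x^{n-j}$ in the polynomial \[ (x-n-2i+1)(x-n-2i+3)\cdots(x-n-2i+2n-1). \] Then for each $0\le j\le n$, $u_j^n$ is a right eigenvector of $K$ with eigenvalue $1/b^j$, i.e. $\sum_{k=-n/2}^{n/2}K(i,k)\,u_j^n[k]=b^{ -j}u_j^n[i]$ for all $-\tfrac n2\le i\le\tfrac n2$.
   Context: Balanced digits base $b$ ($b$ odd) are the integers $-\tfrac{b-1}{2},\dots,\tfrac{b-1}{2}$. When $n$ numbers in balanced digits are added column by column from right to left, if the carry into a column is $i$ and the column digits are $X_1,\dots,X_n$, the carry out is the unique integer $j$ with $jb-\tfrac{b-1}{2}\le i+X_1+\cdots+X_n\le jb+\tfrac{b-1}{2}$; the first carry is $0$. With all digits independent and uniform, the carries form a Markov chain (the balanced carries chain) with state space $\{ -\tfrac n2,\dots,\tfrac n2\}$ for $n$ even; $K(i,j)$ is the probability the carry out is $j$ given carry in $i$. -}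

module Defs where

open import Data.Nat as ℕ using (ℕ; zero; suc)
open import Data.Integer as ℤ using (ℤ; +_; _-_; _≤_; _≤?_)
open import Data.Rational as ℚ using (ℚ)
open import Data.List using (List; []; _∷_; map; concatMap; filter; length; upTo; foldr; _++_)
open import Data.Product using (_×_)
open import Relation.Nullary.Decidable using (Dec; _×-dec_)

-- a / d as a rational; junk value 0 when d = 0 (never used: d is a power of b ≥ 3)
_/ℕ_ : ℤ → ℕ → ℚ
a /ℕ zero = ℚ.0ℚ
a /ℕ suc d = a ℚ./ suc d

halfDigit : ℕ → ℕ
halfDigit b = b ℕ./ 2

digits : ℕ → List ℤ
digits b = map (λ k → + k - + halfDigit b) (upTo b)

tuples : ℕ → ℕ → List (List ℤ)
tuples b zero = [] ∷ []
tuples b (suc n) = concatMap (λ d → map (d ∷_) (tuples b n)) (digits b)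

sumℤ : List ℤ → ℤ
sumℤ = foldr ℤ._+_ (+ 0)

CarryOut : ℕ → ℤ → List ℤ → ℤ → Set
CarryOut b i xs j =
  (j ℤ.* + b - + halfDigit b ≤ i ℤ.+ sumℤ xs) × (i ℤ.+ sumℤ xs ≤ j ℤ.* + b ℤ.+ + halfDigit b)

carryOut? : ∀ b i xs j → Dec (CarryOut b i xs j)
carryOut? b i xs j =
  ((j ℤ.* + b - + halfDigit b) ≤? (i ℤ.+ sumℤ xs)) ×-dec ((i ℤ.+ sumℤ xs) ≤? (j ℤ.* + b ℤ.+ + halfDigit b))

-- transition probability K(i,j) of the balanced carries chain (n summands, base b):
-- #{digit tuples (X_1..X_n) with carry out j from carry in i} / b^n
K : (b n : ℕ) → ℤ → ℤ → ℚ
K b n i j = (+ length (filter (λ xs → carryOut? b i xs j) (tuples b n))) /ℕ (b ℕ.^ n)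

states : ℕ → List ℤ
states n = map (λ t → + t - + (n ℕ./ 2)) (upTo (suc n))

sumℚ : List ℚ → ℚ
sumℚ = foldr ℚ._+_ ℚ.0ℚ

-- polynomials over ℤ as coefficient lists, lowest degree first
addP : List ℤ → List ℤ → List ℤ
addP [] q = q
addP (c ∷ p) [] = c ∷ p
addP (c ∷ p) (d ∷ q) = (c ℤ.+ d) ∷ addP p q

mulLin : ℤ → List ℤ → List ℤ
mulLin a p = addP (+ 0 ∷ p) (map (λ c → ℤ.- a ℤ.* c) p)

prodLin : List ℤ → List ℤ
prodLin = foldr mulLin (+ 1 ∷ [])

coeff : List ℤ → ℕ → ℤ
coeff [] k = + 0
coeff (c ∷ p) zero = c
coeff (c ∷ p) (suc k) = coeff p k

-- the polynomial (x-n-2i+1)(x-n-2i+3)...(x-n-2i+2n-1), i.e. ∏_{r=1}^{n} (x - (n + 2i - (2r-1)))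
uPoly : ℕ → ℤ → List ℤ
uPoly n i = prodLin (map (λ r → + n ℤ.+ + 2 ℤ.* i - + (2 ℕ.* r ℕ.+ 1)) (upTo n))

u : ℕ → ℕ → ℤ → ℤ
u n j i = coeff (uPoly n i) (n ℕ.∸ j)

-- Let h = (b - 1)/2. A column whose total (carry in plus digits) is s has carry out
-- carry s = ⌊(s + h)/b⌋. The heart of the proof is the identity
--   Σ_{X ∈ digits^m} ρ_m(2(w - carry(i + ΣX))) = ρ_m(2(b w + h(m - 1) - i))
-- for the step-2 rising product ρ_m(a) = a(a + 2)⋯(a + 2m - 2) and all integers w, i;
-- both sides have the same difference in i (the sum over one digit telescopes, and
-- shifting the total by b shifts the carry by 1) and both vanish at i = b w + h(m - 1).
-- The polynomial U_k(x) = ρ_n(x - n - 2k + 1), whose coefficients are the u_j^n[k],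
-- equals ρ_n(2(W - k)) at x = 2W + n - 1. So the identity says that Σ_X U_{carry(i+ΣX)}(x)
-- and U_i(b x) agree at infinitely many points, hence have the same coefficients:
-- Σ_X u_j^n[carry(i + ΣX)] = b^(n-j) u_j^n[i]. Grouping the b^n digit tuples by their
-- carry out, which stays in {-n/2, …, n/2}, and dividing by b^n gives K u_j^n = b^(-j) u_j^n.

module Submission where

open import Defs
open import Data.Nat using (ℕ; _^_; _∸_)
open import Data.Nat.Divisibility using (_∣_)
open import Data.Nat.DivMod using (_/_; _%_)
open import Data.Integer using (ℤ; +_; -_; _≤_)
open import Data.Rational using (_*_)
open import Data.List using (map)
open import Relation.Binary.PropositionalEquality using (_≡_)

open import Data.Empty using (⊥-elim)
open import Data.Integer using (0ℤ; 1ℤ; -1ℤ; _+_; _-_; _<_; +≤+; -[1+_]; ∣_∣) renaming (_*_ to _·_)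
import Data.Integer.DivMod as ℤ
import Data.Integer.Properties as ℤ
open import Algebra.Properties.CommutativeSemigroup ℤ.+-commutativeSemigroup using (interchange)
open import Data.Integer.Tactic.RingSolver using (solve; solve-∀)
open import Data.List using (List; []; _∷_; _++_; upTo; applyUpTo; concat; concatMap; filter; foldr; length)
open import Data.List.Properties
  using (map-cong; map-cong-local; map-∘; map-++; concat-map; map-applyUpTo; applyUpTo-∷ʳ)
open import Data.List.Relation.Unary.All as All using (All)
open import Data.List.Relation.Unary.All.Properties using (applyUpTo⁺₁; map⁺; concat⁺)
open import Data.Nat as ℕ using (zero; suc; z≤n)
import Data.Nat.DivMod as ℕ
import Data.Nat.Properties as ℕ
open import Data.Product using (_×_; _,_; proj₁; proj₂; uncurry)
import Data.Rational as ℚ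
import Data.Rational.Properties as ℚ
open import Data.Rational.Unnormalised as ℚᵘ using (mkℚᵘ; *≡*; _≃_)
import Data.Rational.Unnormalised.Properties as ℚᵘ
open import Data.Sum using (inj₁; inj₂)
open import Function using (_∘_)
open import Relation.Nullary using (Dec; yes; no)
open import Relation.Nullary.Decidable using (_×-dec_)
open import Relation.Unary using (Decidable)
open import Relation.Binary.PropositionalEquality
  using (refl; sym; trans; cong; cong₂; subst; _≢_; module ≡-Reasoning)

-- Sums of integers over lists

sumℤ-++ : ∀ xs ys → sumℤ (xs ++ ys) ≡ sumℤ xs + sumℤ ys
sumℤ-++ []       ys = sym (ℤ.+-identityˡ _)
sumℤ-++ (x ∷ xs) ys = trans (cong (_+_ x) (sumℤ-++ xs ys)) (sym (ℤ.+-assoc x _ _))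

sumℤ-concat : ∀ xss → sumℤ (concat xss) ≡ sumℤ (map sumℤ xss)
sumℤ-concat []         = refl
sumℤ-concat (xs ∷ xss) = trans (sumℤ-++ xs (concat xss)) (cong (_+_ (sumℤ xs)) (sumℤ-concat xss))

module _ {A : Set} where

  sumℤ-map-+ : ∀ (f g : A → ℤ) xs →
    sumℤ (map (λ x → f x + g x) xs) ≡ sumℤ (map f xs) + sumℤ (map g xs)
  sumℤ-map-+ f g []       = refl
  sumℤ-map-+ f g (x ∷ xs) =
    trans (cong (_+_ (f x + g x)) (sumℤ-map-+ f g xs)) (interchange (f x) (g x) _ _)

  sumℤ-map-- : ∀ (f g : A → ℤ) xs →
    sumℤ (map (λ x → f x - g x) xs) ≡ sumℤ (map f xs) - sumℤ (map g xs)
  sumℤ-map-- f g []       = refl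
  sumℤ-map-- f g (x ∷ xs) = trans (cong (_+_ (f x - g x)) (sumℤ-map-- f g xs)) (regroup (f x) (g x) _ _)
    where
    regroup : ∀ a b c d → a - b + (c - d) ≡ a + c - (b + d)
    regroup = solve-∀

  sumℤ-map-*ˡ : ∀ a (f : A → ℤ) xs → sumℤ (map (λ x → a · f x) xs) ≡ a · sumℤ (map f xs)
  sumℤ-map-*ˡ a f []       = sym (ℤ.*-zeroʳ a)
  sumℤ-map-*ˡ a f (x ∷ xs) =
    trans (cong (_+_ (a · f x)) (sumℤ-map-*ˡ a f xs)) (sym (ℤ.*-distribˡ-+ a (f x) _))

  sumℤ-map-*ʳ : ∀ a (f : A → ℤ) xs → sumℤ (map (λ x → f x · a) xs) ≡ sumℤ (map f xs) · a
  sumℤ-map-*ʳ a f []       = refl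
  sumℤ-map-*ʳ a f (x ∷ xs) =
    trans (cong (_+_ (f x · a)) (sumℤ-map-*ʳ a f xs)) (sym (ℤ.*-distribʳ-+ a (f x) _))

  sumℤ-map-zero : ∀ {f : A → ℤ} {xs} → All (λ x → f x ≡ 0ℤ) xs → sumℤ (map f xs) ≡ 0ℤ
  sumℤ-map-zero All.[]          = refl
  sumℤ-map-zero (fx≡0 All.∷ ps) = cong₂ _+_ fx≡0 (sumℤ-map-zero ps)

sumℤ-concatMap : ∀ {A B : Set} (f : B → ℤ) (g : A → List B) xs →
  sumℤ (map f (concatMap g xs)) ≡ sumℤ (map (λ x → sumℤ (map f (g x))) xs)
sumℤ-concatMap f g xs = begin
  sumℤ (map f (concat (map g xs)))         ≡⟨ cong sumℤ (sym (concat-map (map g xs))) ⟩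
  sumℤ (concat (map (map f) (map g xs)))   ≡⟨ sumℤ-concat (map (map f) (map g xs)) ⟩
  sumℤ (map sumℤ (map (map f) (map g xs))) ≡⟨ cong sumℤ (sym (trans (map-∘ xs) (map-∘ (map g xs)))) ⟩
  sumℤ (map (λ x → sumℤ (map f (g x))) xs) ∎
  where open ≡-Reasoning

sumℤ-swap : ∀ {A B : Set} (F : A → B → ℤ) xs ys →
  sumℤ (map (λ x → sumℤ (map (F x) ys)) xs) ≡ sumℤ (map (λ y → sumℤ (map (λ x → F x y) xs)) ys)
sumℤ-swap F []       ys = sym (sumℤ-map-zero (All.universal (λ _ → refl) ys))
sumℤ-swap F (x ∷ xs) ys = trans (cong (_+_ (sumℤ (map (F x) ys))) (sumℤ-swap F xs ys))
                                (sym (sumℤ-map-+ (F x) (λ y → sumℤ (map (λ x → F x y) xs)) ys))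

sumℤ-upTo-suc : ∀ (F : ℕ → ℤ) m → sumℤ (map F (upTo (suc m))) ≡ sumℤ (map F (upTo m)) + F m
sumℤ-upTo-suc F m = begin
  sumℤ (map F (upTo (suc m)))          ≡⟨ cong (sumℤ ∘ map F) (sym (applyUpTo-∷ʳ (λ k → k) m)) ⟩
  sumℤ (map F (upTo m ++ m ∷ []))      ≡⟨ cong sumℤ (map-++ F (upTo m) _) ⟩
  sumℤ (map F (upTo m) ++ F m ∷ [])    ≡⟨ sumℤ-++ (map F (upTo m)) _ ⟩
  sumℤ (map F (upTo m)) + (F m + 0ℤ)   ≡⟨ cong (_+_ (sumℤ (map F (upTo m)))) (ℤ.+-identityʳ (F m)) ⟩
  sumℤ (map F (upTo m)) + F m          ∎
  where open ≡-Reasoning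

sumℤ-telescope : ∀ (G : ℕ → ℤ) m → sumℤ (map (G ∘ suc) (upTo m)) - sumℤ (map G (upTo m)) ≡ G m - G 0
sumℤ-telescope G m = begin
  ΣG∘suc - ΣG                                ≡⟨ rearrange ΣG∘suc ΣG (G 0) (G m) ⟩
  G 0 + ΣG∘suc - (ΣG + G m) + G m - G 0
    ≡⟨ cong (λ t → G 0 + sumℤ t - (ΣG + G m) + G m - G 0)
            (trans (map-applyUpTo (λ k → k) (G ∘ suc) m) (sym (map-applyUpTo suc G m))) ⟩
  sumℤ (map G (upTo (suc m))) - (ΣG + G m) + G m - G 0
    ≡⟨ cong (λ t → t - (ΣG + G m) + G m - G 0) (sumℤ-upTo-suc G m) ⟩
  ΣG + G m - (ΣG + G m) + G m - G 0          ≡⟨ cong (λ t → t + G m - G 0) (ℤ.+-inverseʳ (ΣG + G m)) ⟩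
  0ℤ + G m - G 0                             ≡⟨ cong (_- G 0) (ℤ.+-identityˡ (G m)) ⟩
  G m - G 0                                  ∎
  where
  open ≡-Reasoning
  ΣG∘suc ΣG : ℤ
  ΣG∘suc = sumℤ (map (G ∘ suc) (upTo m))
  ΣG = sumℤ (map G (upTo m))
  rearrange : ∀ s t a b → s - t ≡ a + s - (t + b) + b - a
  rearrange = solve-∀

sumℤ-upTo-single : ∀ (F : ℕ → ℤ) m {t} → t ℕ.< m → (∀ {k} → k ℕ.< m → k ≢ t → F k ≡ 0ℤ) →
  sumℤ (map F (upTo m)) ≡ F t
sumℤ-upTo-single F (suc m) {t} t<1+m others
  rewrite sumℤ-upTo-suc F m with ℕ.m<1+n⇒m<n∨m≡n t<1+m
... | inj₁ t<m = trans (cong₂ _+_ (sumℤ-upTo-single F m t<m (others ∘ ℕ.m<n⇒m<1+n))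
                                   (others ℕ.≤-refl (ℕ.<⇒≢ t<m ∘ sym)))
                        (ℤ.+-identityʳ (F t))
... | inj₂ refl = trans (cong (_+ F t) (sumℤ-map-zero (applyUpTo⁺₁ (λ k → k) m below)))
                        (ℤ.+-identityˡ (F t))
  where
  below : ∀ {k} → k ℕ.< t → F k ≡ 0ℤ
  below k<t = others (ℕ.m<n⇒m<1+n k<t) (ℕ.<⇒≢ k<t)

-- Forward differences and step-2 rising products

const-of-Δ≡0 : ∀ (f : ℤ → ℤ) → (∀ i → f (i + 1ℤ) ≡ f i) → ∀ i → f i ≡ f 0ℤ
const-of-Δ≡0 f step = go
  where
  step′ : ∀ i → f (1ℤ + i) ≡ f i
  step′ i = trans (cong f (ℤ.+-comm 1ℤ i)) (step i)
  nonPos : ∀ n → f (- + n) ≡ f 0ℤ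
  nonPos zero    = refl
  nonPos (suc n) = trans (sym (step′ -[1+ n ])) (trans (cong f (ℤ.1-[1+n]≡-n n)) (nonPos n))
  go : ∀ i → f i ≡ f 0ℤ
  go (+ zero)  = refl
  go (+ suc n) = trans (step′ (+ n)) (go (+ n))
  go -[1+ n ]  = nonPos (suc n)

≗-from-Δ : ∀ (f g : ℤ → ℤ) {i₀} → (∀ i → f (i + 1ℤ) - f i ≡ g (i + 1ℤ) - g i) → f i₀ ≡ g i₀ →
  ∀ i → f i ≡ g i
≗-from-Δ f g {i₀} Δf≡Δg f≡g i = ℤ.i-j≡0⇒i≡j (f i) (g i) (begin
  f i - g i     ≡⟨ const-of-Δ≡0 D ΔD≡0 i ⟩
  D 0ℤ          ≡⟨ sym (const-of-Δ≡0 D ΔD≡0 i₀) ⟩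
  f i₀ - g i₀   ≡⟨ ℤ.i≡j⇒i-j≡0 f≡g ⟩
  0ℤ            ∎)
  where
  open ≡-Reasoning
  D : ℤ → ℤ
  D i = f i - g i
  transpose : ∀ a b c d → a - b ≡ c - d → a - c ≡ b - d
  transpose a b c d eq = begin
    a - c               ≡⟨ solve (a ∷ b ∷ c ∷ []) ⟩
    (a - b) + (b - c)   ≡⟨ cong (_+ (b - c)) eq ⟩
    (c - d) + (b - c)   ≡⟨ solve (b ∷ c ∷ d ∷ []) ⟩
    b - d               ∎
  ΔD≡0 : ∀ i → D (i + 1ℤ) ≡ D i
  ΔD≡0 i = transpose (f (i + 1ℤ)) (f i) (g (i + 1ℤ)) (g i) (Δf≡Δg i)

rising₂ : ℕ → ℤ → ℤ
rising₂ zero    a = 1ℤ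
rising₂ (suc m) a = a · rising₂ m (a + + 2)

rising₂-suc-last : ∀ m a → rising₂ (suc m) a ≡ rising₂ m a · (a + + 2 · + m)
rising₂-suc-last zero    a = solve (a ∷ [])
rising₂-suc-last (suc m) a = begin
  a · rising₂ (suc m) (a + + 2)                           ≡⟨ cong (a ·_) (rising₂-suc-last m (a + + 2)) ⟩
  a · (rising₂ m (a + + 2) · (a + + 2 + + 2 · + m))       ≡⟨ regroup a (rising₂ m (a + + 2)) (+ m) ⟩
  a · rising₂ m (a + + 2) · (a + + 2 · (1ℤ + + m))        ∎
  where
  open ≡-Reasoning
  regroup : ∀ a p x → a · (p · (a + + 2 + + 2 · x)) ≡ a · p · (a + + 2 · (1ℤ + x))
  regroup = solve-∀

rising₂-Δ : ∀ m a → rising₂ (suc m) (a - + 2) - rising₂ (suc m) a ≡ - (+ 2 · (1ℤ + + m)) · rising₂ m a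
rising₂-Δ m a = begin
  (a - + 2) · rising₂ m (a - + 2 + + 2) - rising₂ (suc m) a
    ≡⟨ cong₂ (λ x y → (a - + 2) · rising₂ m x - y) (solve (a ∷ [])) (rising₂-suc-last m a) ⟩
  (a - + 2) · rising₂ m a - rising₂ m a · (a + + 2 · + m)
    ≡⟨ collect a (rising₂ m a) (+ m) ⟩
  - (+ 2 · (1ℤ + + m)) · rising₂ m a ∎
  where
  open ≡-Reasoning
  collect : ∀ a p x → (a - + 2) · p - p · (a + + 2 · x) ≡ - (+ 2 · (1ℤ + x)) · p
  collect = solve-∀

rising₂≡0 : ∀ m {w k} → w ≤ k → k ≤ w + + m → rising₂ (suc m) (+ 2 · (w - k)) ≡ 0ℤ
rising₂≡0 m {w} {k} w≤k k≤w+m with w ℤ.≟ k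
rising₂≡0 m {w} w≤k k≤w+m | yes refl =
  trans (cong (λ x → + 2 · x · rising₂ m (+ 2 · (w - w) + + 2)) (ℤ.+-inverseʳ w))
        (ℤ.*-zeroˡ (rising₂ m (+ 2 · (w - w) + + 2)))
rising₂≡0 zero {w} {k} w≤k k≤w+0 | no w≢k =
  ⊥-elim (w≢k (ℤ.≤-antisym w≤k (subst (k ≤_) (ℤ.+-identityʳ w) k≤w+0)))
rising₂≡0 (suc m) {w} {k} w≤k k≤w+1+m | no w≢k = begin
  + 2 · (w - k) · rising₂ (suc m) (+ 2 · (w - k) + + 2)
    ≡⟨ cong (λ x → + 2 · (w - k) · rising₂ (suc m) x) (shift w k) ⟩
  + 2 · (w - k) · rising₂ (suc m) (+ 2 · (1ℤ + w - k))
    ≡⟨ cong (+ 2 · (w - k) ·_) (rising₂≡0 m 1+w≤k k≤1+w+m) ⟩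
  + 2 · (w - k) · 0ℤ
    ≡⟨ ℤ.*-zeroʳ (+ 2 · (w - k)) ⟩
  0ℤ ∎
  where
  open ≡-Reasoning
  shift : ∀ w k → + 2 · (w - k) + + 2 ≡ + 2 · (1ℤ + w - k)
  shift = solve-∀
  reassoc : ∀ w x → w + (1ℤ + x) ≡ 1ℤ + w + x
  reassoc = solve-∀
  1+w≤k : 1ℤ + w ≤ k
  1+w≤k = ℤ.i<j⇒suc[i]≤j (ℤ.≤∧≢⇒< w≤k w≢k)
  k≤1+w+m : k ≤ 1ℤ + w + + m
  k≤1+w+m = ℤ.≤-trans k≤w+1+m (ℤ.≤-reflexive (reassoc w (+ m)))

-- Polynomials as coefficient lists

eval : List ℤ → ℤ → ℤ
eval []      y = 0ℤ
eval (c ∷ p) y = c + y · eval p y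

eval-addP : ∀ p q y → eval (addP p q) y ≡ eval p y + eval q y
eval-addP []      q       y = sym (ℤ.+-identityˡ _)
eval-addP (c ∷ p) []      y = sym (ℤ.+-identityʳ _)
eval-addP (c ∷ p) (d ∷ q) y =
  trans (cong (λ t → c + d + y · t) (eval-addP p q y)) (distrib c d y (eval p y) (eval q y))
  where
  distrib : ∀ c d y s t → c + d + y · (s + t) ≡ c + y · s + (d + y · t)
  distrib = solve-∀

coeff-addP : ∀ p q e → coeff (addP p q) e ≡ coeff p e + coeff q e
coeff-addP []      q       e       = sym (ℤ.+-identityˡ _)
coeff-addP (c ∷ p) []      e       = sym (ℤ.+-identityʳ _)
coeff-addP (c ∷ p) (d ∷ q) zero    = refl
coeff-addP (c ∷ p) (d ∷ q) (suc e) = coeff-addP p q e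

eval-scale : ∀ a p y → eval (map (a ·_) p) y ≡ a · eval p y
eval-scale a []      y = sym (ℤ.*-zeroʳ a)
eval-scale a (c ∷ p) y = trans (cong (λ t → a · c + y · t) (eval-scale a p y)) (distrib a c y (eval p y))
  where
  distrib : ∀ a c y t → a · c + y · (a · t) ≡ a · (c + y · t)
  distrib = solve-∀

coeff-scale : ∀ a p e → coeff (map (a ·_) p) e ≡ a · coeff p e
coeff-scale a []      e       = sym (ℤ.*-zeroʳ a)
coeff-scale a (c ∷ p) zero    = refl
coeff-scale a (c ∷ p) (suc e) = coeff-scale a p e

eval-mulLin : ∀ a p y → eval (mulLin a p) y ≡ (y - a) · eval p y
eval-mulLin a p y = begin
  eval (addP (0ℤ ∷ p) (map (- a ·_) p)) y   ≡⟨ eval-addP (0ℤ ∷ p) (map (- a ·_) p) y ⟩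
  0ℤ + y · eval p y + eval (map (- a ·_) p) y ≡⟨ cong (_+_ (0ℤ + y · eval p y)) (eval-scale (- a) p y) ⟩
  0ℤ + y · eval p y + - a · eval p y         ≡⟨ collect a y (eval p y) ⟩
  (y - a) · eval p y                         ∎
  where
  open ≡-Reasoning
  collect : ∀ a y t → 0ℤ + y · t + - a · t ≡ (y - a) · t
  collect = solve-∀

eval-prodLin-rising₂ : ∀ n (root : ℕ → ℤ) y a → (∀ r → y - root r ≡ a + + 2 · + r) →
  eval (prodLin (applyUpTo root n)) y ≡ rising₂ n a
eval-prodLin-rising₂ zero    root y a roots = cong (_+_ 1ℤ) (ℤ.*-zeroʳ y)
eval-prodLin-rising₂ (suc n) root y a roots = begin
  eval (mulLin (root 0) (prodLin (applyUpTo (root ∘ suc) n))) y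
    ≡⟨ eval-mulLin (root 0) (prodLin (applyUpTo (root ∘ suc) n)) y ⟩
  (y - root 0) · eval (prodLin (applyUpTo (root ∘ suc) n)) y
    ≡⟨ cong₂ _·_ (trans (roots 0) (ℤ.+-identityʳ a)) (eval-prodLin-rising₂ n (root ∘ suc) y (a + + 2) roots′) ⟩
  a · rising₂ n (a + + 2) ∎
  where
  open ≡-Reasoning
  shift : ∀ a x → a + + 2 · (1ℤ + x) ≡ a + + 2 + + 2 · x
  shift = solve-∀
  roots′ : ∀ r → y - root (suc r) ≡ a + + 2 + + 2 · + r
  roots′ r = trans (roots (suc r)) (shift a (+ r))

eval-uPoly : ∀ n k y → eval (uPoly n k) y ≡ rising₂ n (y - + n - + 2 · k + 1ℤ)
eval-uPoly n k y = trans (cong (λ rs → eval (prodLin rs) y) (map-applyUpTo (λ r → r) root n))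
                         (eval-prodLin-rising₂ n root y _ roots)
  where
  root : ℕ → ℤ
  root r = + n + + 2 · k - + (2 ℕ.* r ℕ.+ 1)
  odd : ∀ r → + (2 ℕ.* r ℕ.+ 1) ≡ + 2 · + r + 1ℤ
  odd r = trans (ℤ.pos-+ (2 ℕ.* r) 1) (cong (_+ 1ℤ) (ℤ.pos-* 2 r))
  expand : ∀ y n k r → y - (n + + 2 · k - (+ 2 · r + 1ℤ)) ≡ y - n - + 2 · k + 1ℤ + + 2 · r
  expand = solve-∀
  roots : ∀ r → y - root r ≡ y - + n - + 2 · k + 1ℤ + + 2 · + r
  roots r = trans (cong (λ t → y - (+ n + + 2 · k - t)) (odd r)) (expand y (+ n) k (+ r))

eval-uPoly-at-2W+A : ∀ A W k → eval (uPoly (suc A) k) (+ 2 · W + + A) ≡ rising₂ (suc A) (+ 2 · (W - k))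
eval-uPoly-at-2W+A A W k =
  trans (eval-uPoly (suc A) k (+ 2 · W + + A)) (cong (rising₂ (suc A)) (simplify W (+ A) k))
  where
  simplify : ∀ W A k → + 2 · W + A - (1ℤ + A) - + 2 · k + 1ℤ ≡ + 2 · (W - k)
  simplify = solve-∀

sumP : List (List ℤ) → List ℤ
sumP = foldr addP []

eval-sumP : ∀ ps y → eval (sumP ps) y ≡ sumℤ (map (λ p → eval p y) ps)
eval-sumP []       y = refl
eval-sumP (p ∷ ps) y = trans (eval-addP p (sumP ps) y) (cong (_+_ (eval p y)) (eval-sumP ps y))

coeff-sumP : ∀ ps e → coeff (sumP ps) e ≡ sumℤ (map (λ p → coeff p e) ps)
coeff-sumP []       e = refl
coeff-sumP (p ∷ ps) e = trans (coeff-addP p (sumP ps) e) (cong (_+_ (coeff p e)) (coeff-sumP ps e))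

dilate : ℕ → List ℤ → List ℤ
dilate β []      = []
dilate β (c ∷ p) = c ∷ map (+ β ·_) (dilate β p)

eval-dilate : ∀ β p y → eval (dilate β p) y ≡ eval p (+ β · y)
eval-dilate β []      y = refl
eval-dilate β (c ∷ p) y = begin
  c + y · eval (map (+ β ·_) (dilate β p)) y  ≡⟨ cong (λ t → c + y · t) (eval-scale (+ β) (dilate β p) y) ⟩
  c + y · (+ β · eval (dilate β p) y)         ≡⟨ cong (λ t → c + y · (+ β · t)) (eval-dilate β p y) ⟩
  c + y · (+ β · eval p (+ β · y))            ≡⟨ regroup c y (+ β) (eval p (+ β · y)) ⟩
  c + + β · y · eval p (+ β · y)              ∎
  where
  open ≡-Reasoning
  regroup : ∀ c y b t → c + y · (b · t) ≡ c + b · y · t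
  regroup = solve-∀

coeff-dilate : ∀ β p e → coeff (dilate β p) e ≡ + (β ^ e) · coeff p e
coeff-dilate β []      e       = sym (ℤ.*-zeroʳ (+ (β ^ e)))
coeff-dilate β (c ∷ p) zero    = sym (ℤ.*-identityˡ c)
coeff-dilate β (c ∷ p) (suc e) = begin
  coeff (map (+ β ·_) (dilate β p)) e  ≡⟨ coeff-scale (+ β) (dilate β p) e ⟩
  + β · coeff (dilate β p) e           ≡⟨ cong (+ β ·_) (coeff-dilate β p e) ⟩
  + β · (+ (β ^ e) · coeff p e)        ≡⟨ sym (ℤ.*-assoc (+ β) (+ (β ^ e)) (coeff p e)) ⟩
  + β · + (β ^ e) · coeff p e          ≡⟨ cong (_· coeff p e) (sym (ℤ.pos-* β (β ^ e))) ⟩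
  + (β ^ suc e) · coeff p e            ∎
  where open ≡-Reasoning

-- Writing p = c + x·q, the point y ∣ c ∣ > ∣ c ∣ gives c = - y·q(y), which forces q(y) = 0 and c = 0.
coeff≡0-of-eval≡0 : ∀ p (y : ℕ → ℕ) → (∀ w → w ℕ.< y w) → (∀ w → eval p (+ y w) ≡ 0ℤ) →
  ∀ e → coeff p e ≡ 0ℤ
coeff≡0-of-eval≡0 []      y y>w vanishes e = refl
coeff≡0-of-eval≡0 (c ∷ p) y y>w vanishes = coeffs
  where
  tail : ℕ → ℤ
  tail w = eval p (+ y w)
  isolate : ∀ c t → c ≡ c + t - t
  isolate = solve-∀
  c≡-y·tail : ∀ w → c ≡ - (+ y w · tail w)
  c≡-y·tail w = trans (isolate c (+ y w · tail w))
                      (trans (cong (_- (+ y w · tail w)) (vanishes w)) (ℤ.+-identityˡ _))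
  c≡0 : c ≡ 0ℤ
  c≡0 with tail ∣ c ∣ ℤ.≟ 0ℤ
  ... | yes t≡0 =
    trans (c≡-y·tail ∣ c ∣) (trans (cong (λ t → - (+ y ∣ c ∣ · t)) t≡0) (cong -_ (ℤ.*-zeroʳ (+ y ∣ c ∣))))
  ... | no t≢0 = ⊥-elim (ℕ.<⇒≱ (y>w ∣ c ∣) y≤∣c∣)
    where
    instance
      tail-nonZero : ℕ.NonZero ∣ tail ∣ c ∣ ∣
      tail-nonZero = ℕ.≢-nonZero (t≢0 ∘ ℤ.∣i∣≡0⇒i≡0)
    ∣c∣≡y·∣tail∣ : ∣ c ∣ ≡ y ∣ c ∣ ℕ.* ∣ tail ∣ c ∣ ∣
    ∣c∣≡y·∣tail∣ = trans (cong ∣_∣ (c≡-y·tail ∣ c ∣))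
                         (trans (ℤ.∣-i∣≡∣i∣ (+ y ∣ c ∣ · tail ∣ c ∣)) (ℤ.abs-* (+ y ∣ c ∣) (tail ∣ c ∣)))
    y≤∣c∣ : y ∣ c ∣ ℕ.≤ ∣ c ∣
    y≤∣c∣ = subst (y ∣ c ∣ ℕ.≤_) (sym ∣c∣≡y·∣tail∣) (ℕ.m≤m*n (y ∣ c ∣) ∣ tail ∣ c ∣ ∣)
  y·tail≡0 : ∀ w → + y w · tail w ≡ 0ℤ
  y·tail≡0 w = trans (sym (ℤ.+-identityˡ _)) (trans (cong (_+ (+ y w · tail w)) (sym c≡0)) (vanishes w))
  tail≡0 : ∀ w → tail w ≡ 0ℤ
  tail≡0 w with ℤ.i*j≡0⇒i≡0∨j≡0 (+ y w) (y·tail≡0 w)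
  ... | inj₁ y≡0 = ⊥-elim (ℕ.m<n⇒n≢0 (y>w w) (cong ∣_∣ y≡0))
  ... | inj₂ t≡0 = t≡0
  coeffs : ∀ e → coeff (c ∷ p) e ≡ 0ℤ
  coeffs zero    = c≡0
  coeffs (suc e) = coeff≡0-of-eval≡0 p y y>w tail≡0 e

coeff-≡-of-eval-≡ : ∀ p q (y : ℕ → ℕ) → (∀ w → w ℕ.< y w) → (∀ w → eval p (+ y w) ≡ eval q (+ y w)) →
  ∀ e → coeff p e ≡ coeff q e
coeff-≡-of-eval-≡ p q y y>w agree e = ℤ.i-j≡0⇒i≡j (coeff p e) (coeff q e) (begin
  coeff p e - coeff q e
    ≡⟨ cong (_+_ (coeff p e)) (sym (trans (coeff-scale -1ℤ q e) (ℤ.-1*i≡-i (coeff q e)))) ⟩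
  coeff p e + coeff (−q) e     ≡⟨ sym (coeff-addP p (−q) e) ⟩
  coeff (addP p (−q)) e        ≡⟨ coeff≡0-of-eval≡0 (addP p (−q)) y y>w difference≡0 e ⟩
  0ℤ                           ∎)
  where
  open ≡-Reasoning
  −q : List ℤ
  −q = map (-1ℤ ·_) q
  difference≡0 : ∀ w → eval (addP p (−q)) (+ y w) ≡ 0ℤ
  difference≡0 w = begin
    eval (addP p (−q)) (+ y w)                       ≡⟨ eval-addP p (−q) (+ y w) ⟩
    eval p (+ y w) + eval (−q) (+ y w)
      ≡⟨ cong (_+_ (eval p (+ y w))) (trans (eval-scale -1ℤ q (+ y w)) (ℤ.-1*i≡-i _)) ⟩
    eval p (+ y w) - eval q (+ y w)                  ≡⟨ ℤ.i≡j⇒i-j≡0 (agree w) ⟩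
    0ℤ                                               ∎

-- Counting and rational arithmetic

indicator : ∀ {A : Set} → Dec A → ℤ
indicator (yes _) = 1ℤ
indicator (no _)  = 0ℤ

length-filter : ∀ {A : Set} {P : A → Set} (P? : Decidable P) xs →
  + length (filter P? xs) ≡ sumℤ (map (indicator ∘ P?) xs)
length-filter P? []       = refl
length-filter P? (x ∷ xs) with P? x
... | yes _ = trans (ℤ.pos-+ 1 _) (cong (_+_ 1ℤ) (length-filter P? xs))
... | no _  = trans (length-filter P? xs) (sym (ℤ.+-identityˡ _))

toℚᵘ-/ℕ : ∀ a d → ℚ.toℚᵘ (a /ℕ suc d) ≃ mkℚᵘ a d
toℚᵘ-/ℕ a d = ℚ.toℚᵘ-fromℚᵘ (mkℚᵘ a d)

/ℕ-*-/ℕ1 : ∀ d a c → (a /ℕ suc d) * (c /ℕ 1) ≡ (a · c) /ℕ suc d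
/ℕ-*-/ℕ1 d a c = ℚ.toℚᵘ-injective (begin
  ℚ.toℚᵘ ((a /ℕ suc d) * (c /ℕ 1))           ≈⟨ ℚ.toℚᵘ-homo-* (a /ℕ suc d) (c /ℕ 1) ⟩
  ℚ.toℚᵘ (a /ℕ suc d) ℚᵘ.* ℚ.toℚᵘ (c /ℕ 1)   ≈⟨ ℚᵘ.*-cong (toℚᵘ-/ℕ a d) (toℚᵘ-/ℕ c 0) ⟩
  mkℚᵘ a d ℚᵘ.* mkℚᵘ c 0                      ≈⟨ *≡* (cong (λ t → a · c · + suc t) (sym (ℕ.*-identityʳ d))) ⟩
  mkℚᵘ (a · c) d                              ≈⟨ ℚᵘ.≃-sym (toℚᵘ-/ℕ (a · c) d) ⟩
  ℚ.toℚᵘ ((a · c) /ℕ suc d)                   ∎)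
  where open ℚᵘ.≃-Reasoning

/ℕ-+-/ℕ : ∀ d a c → (a /ℕ suc d) ℚ.+ (c /ℕ suc d) ≡ (a + c) /ℕ suc d
/ℕ-+-/ℕ d a c = ℚ.toℚᵘ-injective (begin
  ℚ.toℚᵘ ((a /ℕ suc d) ℚ.+ (c /ℕ suc d))           ≈⟨ ℚ.toℚᵘ-homo-+ (a /ℕ suc d) (c /ℕ suc d) ⟩
  ℚ.toℚᵘ (a /ℕ suc d) ℚᵘ.+ ℚ.toℚᵘ (c /ℕ suc d)     ≈⟨ ℚᵘ.+-cong (toℚᵘ-/ℕ a d) (toℚᵘ-/ℕ c d) ⟩
  mkℚᵘ a d ℚᵘ.+ mkℚᵘ c d
    ≈⟨ *≡* (trans (factor a c (+ suc d)) (cong ((a + c) ·_) (sym (ℤ.pos-* (suc d) (suc d))))) ⟩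
  mkℚᵘ (a + c) d                                    ≈⟨ ℚᵘ.≃-sym (toℚᵘ-/ℕ (a + c) d) ⟩
  ℚ.toℚᵘ ((a + c) /ℕ suc d)                         ∎)
  where
  open ℚᵘ.≃-Reasoning
  factor : ∀ a c s → (a · s + c · s) · s ≡ (a + c) · (s · s)
  factor = solve-∀

sumℚ-/ℕ : ∀ {A : Set} D .{{_ : ℕ.NonZero D}} (f g : A → ℤ) xs →
  sumℚ (map (λ x → (f x /ℕ D) * (g x /ℕ 1)) xs) ≡ sumℤ (map (λ x → f x · g x) xs) /ℕ D
sumℚ-/ℕ (suc d) f g []       = sym (ℚ.0/n≡0 (suc d))
sumℚ-/ℕ (suc d) f g (x ∷ xs) = trans (cong₂ ℚ._+_ (/ℕ-*-/ℕ1 d (f x) (g x)) (sumℚ-/ℕ (suc d) f g xs))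
                                     (/ℕ-+-/ℕ d (f x · g x) (sumℤ (map (λ x → f x · g x) xs)))

·/ℕ-cancelˡ : ∀ p q r .{{_ : ℕ.NonZero q}} .{{_ : ℕ.NonZero r}} x → r ≡ p ℕ.* q →
  (+ p · x) /ℕ r ≡ (1ℤ /ℕ q) * (x /ℕ 1)
·/ℕ-cancelˡ p (suc q) (suc r) x r≡pq = ℚ.toℚᵘ-injective (begin
  ℚ.toℚᵘ ((+ p · x) /ℕ suc r)                   ≈⟨ toℚᵘ-/ℕ (+ p · x) r ⟩
  mkℚᵘ (+ p · x) r                               ≈⟨ *≡* cross ⟩
  mkℚᵘ 1ℤ q ℚᵘ.* mkℚᵘ x 0                        ≈⟨ ℚᵘ.≃-sym (ℚᵘ.*-cong (toℚᵘ-/ℕ 1ℤ q) (toℚᵘ-/ℕ x 0)) ⟩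
  ℚ.toℚᵘ (1ℤ /ℕ suc q) ℚᵘ.* ℚ.toℚᵘ (x /ℕ 1)      ≈⟨ ℚᵘ.≃-sym (ℚ.toℚᵘ-homo-* (1ℤ /ℕ suc q) (x /ℕ 1)) ⟩
  ℚ.toℚᵘ ((1ℤ /ℕ suc q) * (x /ℕ 1))              ∎)
  where
  open ℚᵘ.≃-Reasoning
  regroup : ∀ p x s → p · x · s ≡ 1ℤ · x · (p · s)
  regroup = solve-∀
  cross : + p · x · + suc (q ℕ.* 1) ≡ 1ℤ · x · + suc r
  cross = trans (cong (λ t → + p · x · + suc t) (ℕ.*-identityʳ q))
         (trans (regroup (+ p) x (+ suc q))
                (cong (1ℤ · x ·_) (trans (sym (ℤ.pos-* p (suc q))) (cong +_ (sym r≡pq)))))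

-- Balanced carries

module BalancedCarries (b : ℕ) (b≡1+2h : b ≡ suc (2 ℕ.* halfDigit b)) where

  instance
    b-nonZero : ℕ.NonZero b
    b-nonZero = subst ℕ.NonZero (sym b≡1+2h) _

  h : ℕ
  h = halfDigit b

  b≡1+h+h : b ≡ suc (h ℕ.+ h)
  b≡1+h+h = trans b≡1+2h (cong (λ t → suc (h ℕ.+ t)) (ℕ.+-identityʳ h))

  b≡h+h+1 : + b ≡ + h + + h + 1ℤ
  b≡h+h+1 = begin
    + b                    ≡⟨ cong +_ b≡1+h+h ⟩
    + (1 ℕ.+ (h ℕ.+ h))    ≡⟨ ℤ.pos-+ 1 (h ℕ.+ h) ⟩
    1ℤ + + (h ℕ.+ h)       ≡⟨ ℤ.+-comm 1ℤ (+ (h ℕ.+ h)) ⟩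
    + (h ℕ.+ h) + 1ℤ       ≡⟨ cong (_+ 1ℤ) (ℤ.pos-+ h h) ⟩
    + h + + h + 1ℤ         ∎
    where open ≡-Reasoning

  InWindow : ℤ → ℤ → Set
  InWindow s k = (k · + b - + h ≤ s) × (s ≤ k · + b + + h)

  -- CarryOut b i xs k and carryOut? b i xs k are, by definition,
  -- InWindow (i + sumℤ xs) k and inWindow? (i + sumℤ xs) k.
  inWindow? : ∀ s k → Dec (InWindow s k)
  inWindow? s k = (k · + b - + h ℤ.≤? s) ×-dec (s ℤ.≤? k · + b + + h)

  carry : ℤ → ℤ
  carry s = (s + + h) ℤ./ℕ b

  window-≤ : ∀ {j k} → j · + b - + h ≤ k · + b + + h → j ≤ k
  window-≤ {j} {k} w =
    subst (j ≤_) (ℤ.pred-suc k) (ℤ.i<j⇒i≤pred[j] (ℤ.*-cancelʳ-<-nonNeg {j} {1ℤ + k} (+ b) jb<[1+k]b))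
    where
    open ℤ.≤-Reasoning
    sub-add : ∀ x y → x ≡ x - y + y
    sub-add = solve-∀
    regroup : ∀ x y → 1ℤ + (x + y + y) ≡ x + (y + y + 1ℤ)
    regroup = solve-∀
    jb<[1+k]b : j · + b < (1ℤ + k) · + b
    jb<[1+k]b = begin-strict
      j · + b                         ≡⟨ sub-add (j · + b) (+ h) ⟩
      j · + b - + h + + h             ≤⟨ ℤ.+-monoˡ-≤ (+ h) w ⟩
      k · + b + + h + + h             <⟨ ℤ.suc[i]≤j⇒i<j ℤ.≤-refl ⟩
      1ℤ + (k · + b + + h + + h)      ≡⟨ regroup (k · + b) (+ h) ⟩
      k · + b + (+ h + + h + 1ℤ)      ≡⟨ cong (_+_ (k · + b)) (sym b≡h+h+1) ⟩
      k · + b + + b                   ≡⟨ trans (ℤ.+-comm (k · + b) (+ b)) (sym (ℤ.suc-* k (+ b))) ⟩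
      (1ℤ + k) · + b                  ∎

  carry-inWindow : ∀ s → InWindow s (carry s)
  carry-inWindow s = lower , upper
    where
    open ℤ.≤-Reasoning
    q : ℤ
    q = carry s
    r : ℕ
    r = (s + + h) ℤ.%ℕ b
    divMod : s + + h ≡ + r + q · + b
    divMod = ℤ.a≡a%ℕn+[a/ℕn]*n (s + + h) b
    r≤h+h : + r ≤ + h + + h
    r≤h+h = subst (+ r ≤_) (ℤ.pos-+ h h) (+≤+ (ℕ.≤-pred (subst (r ℕ.<_) b≡1+h+h (ℤ.n%ℕd<d (s + + h) b))))
    add-sub : ∀ x y → x + y - y ≡ x
    add-sub = solve-∀
    regroup : ∀ x y → x + x + y - x ≡ y + x
    regroup = solve-∀
    lower : q · + b - + h ≤ s
    lower = begin
      q · + b - + h             ≤⟨ ℤ.+-monoˡ-≤ (- + h) (ℤ.i≤j+i (q · + b) (+ r)) ⟩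
      + r + q · + b - + h       ≡⟨ cong (_- + h) (sym divMod) ⟩
      s + + h - + h             ≡⟨ add-sub s (+ h) ⟩
      s                         ∎
    upper : s ≤ q · + b + + h
    upper = begin
      s                         ≡⟨ sym (add-sub s (+ h)) ⟩
      s + + h - + h             ≡⟨ cong (_- + h) divMod ⟩
      + r + q · + b - + h       ≤⟨ ℤ.+-monoˡ-≤ (- + h) (ℤ.+-monoˡ-≤ (q · + b) r≤h+h) ⟩
      + h + + h + q · + b - + h ≡⟨ regroup (+ h) (q · + b) ⟩
      q · + b + + h             ∎

  ≤-carry : ∀ {s k} → k · + b - + h ≤ s → k ≤ carry s
  ≤-carry {s} lo = window-≤ (ℤ.≤-trans lo (proj₂ (carry-inWindow s)))

  carry-≤ : ∀ {s k} → s ≤ k · + b + + h → carry s ≤ k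
  carry-≤ {s} hi = window-≤ (ℤ.≤-trans (proj₁ (carry-inWindow s)) hi)

  carry-unique : ∀ {s k} → InWindow s k → k ≡ carry s
  carry-unique (lo , hi) = ℤ.≤-antisym (≤-carry lo) (carry-≤ hi)

  carry-+b : ∀ s → carry (s + + b) ≡ carry s + 1ℤ
  carry-+b s = sym (carry-unique (lower , upper))
    where
    open ℤ.≤-Reasoning
    q : ℤ
    q = carry s
    shiftₗ : ∀ x y z → (x + 1ℤ) · y - z ≡ x · y - z + y
    shiftₗ = solve-∀
    shiftᵤ : ∀ x y z → x · y + z + y ≡ (x + 1ℤ) · y + z
    shiftᵤ = solve-∀
    lower : (q + 1ℤ) · + b - + h ≤ s + + b
    lower = begin
      (q + 1ℤ) · + b - + h      ≡⟨ shiftₗ q (+ b) (+ h) ⟩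
      q · + b - + h + + b       ≤⟨ ℤ.+-monoˡ-≤ (+ b) (proj₁ (carry-inWindow s)) ⟩
      s + + b                   ∎
    upper : s + + b ≤ (q + 1ℤ) · + b + + h
    upper = begin
      s + + b                   ≤⟨ ℤ.+-monoˡ-≤ (+ b) (proj₂ (carry-inWindow s)) ⟩
      q · + b + + h + + b       ≡⟨ shiftᵤ q (+ b) (+ h) ⟩
      (q + 1ℤ) · + b + + h      ∎

  Bounded : ℕ → ℤ → Set
  Bounded m s = - (+ m · + h) ≤ s × s ≤ + m · + h

  digits-bounded : All (Bounded 1) (digits b)
  digits-bounded = map⁺ (applyUpTo⁺₁ (λ k → k) b bounds)
    where
    open ℤ.≤-Reasoning
    bounds : ∀ {k} → k ℕ.< b → Bounded 1 (+ k - + h)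
    bounds {k} k<b = lower , upper
      where
      lower : - (1ℤ · + h) ≤ + k - + h
      lower = begin
        - (1ℤ · + h)  ≡⟨ cong -_ (ℤ.*-identityˡ (+ h)) ⟩
        - + h         ≡⟨ sym (ℤ.+-identityˡ (- + h)) ⟩
        0ℤ - + h      ≤⟨ ℤ.+-monoˡ-≤ (- + h) (+≤+ z≤n) ⟩
        + k - + h     ∎
      cancel : ∀ x → x + x - x ≡ 1ℤ · x
      cancel = solve-∀
      upper : + k - + h ≤ 1ℤ · + h
      upper = begin
        + k - + h           ≤⟨ ℤ.+-monoˡ-≤ (- + h) (+≤+ (ℕ.≤-pred (subst (k ℕ.<_) b≡1+h+h k<b))) ⟩
        + (h ℕ.+ h) - + h   ≡⟨ cong (_- + h) (ℤ.pos-+ h h) ⟩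
        + h + + h - + h     ≡⟨ cancel (+ h) ⟩
        1ℤ · + h            ∎

  Bounded-+ : ∀ {m d s} → Bounded 1 d → Bounded m s → Bounded (suc m) (d + s)
  Bounded-+ {m} {d} {s} (d≥ , d≤) (s≥ , s≤) =
    ℤ.≤-trans (ℤ.≤-reflexive (split-neg (+ m) (+ h))) (ℤ.+-mono-≤ d≥ s≥) ,
    ℤ.≤-trans (ℤ.+-mono-≤ d≤ s≤) (ℤ.≤-reflexive (split (+ m) (+ h)))
    where
    split-neg : ∀ x y → - ((1ℤ + x) · y) ≡ - (1ℤ · y) + - (x · y)
    split-neg = solve-∀
    split : ∀ x y → 1ℤ · y + x · y ≡ (1ℤ + x) · y
    split = solve-∀

  tuples-bounded : ∀ m → All (Bounded m ∘ sumℤ) (tuples b m)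
  tuples-bounded zero    = (ℤ.≤-refl , ℤ.≤-refl) All.∷ All.[]
  tuples-bounded (suc m) =
    concat⁺ (map⁺ (All.map (λ bd → map⁺ (All.map (Bounded-+ {m} bd) (tuples-bounded m))) digits-bounded))

  sumℤ-digits-telescope : ∀ (f : ℤ → ℤ) i →
    sumℤ (map (λ d → f (i + 1ℤ + d)) (digits b)) - sumℤ (map (λ d → f (i + d)) (digits b))
      ≡ f (i + + h + 1ℤ) - f (i - + h)
  sumℤ-digits-telescope f i = begin
    sumℤ (map (λ d → f (i + 1ℤ + d)) (digits b)) - sumℤ (map (λ d → f (i + d)) (digits b))
      ≡⟨ cong₂ _-_ (cong sumℤ (trans (sym (map-∘ (upTo b))) (map-cong (cong f ∘ shift) (upTo b))))
                   (cong sumℤ (sym (map-∘ (upTo b)))) ⟩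
    sumℤ (map (G ∘ suc) (upTo b)) - sumℤ (map G (upTo b))
      ≡⟨ sumℤ-telescope G b ⟩
    G b - G 0
      ≡⟨ cong₂ (λ x y → f x - f y) (trans (cong (λ t → i + (t - + h)) b≡h+h+1) (top i (+ h))) (bottom i (+ h)) ⟩
    f (i + + h + 1ℤ) - f (i - + h) ∎
    where
    open ≡-Reasoning
    G : ℕ → ℤ
    G k = f (i + (+ k - + h))
    regroup : ∀ x y z → x + 1ℤ + (y - z) ≡ x + (1ℤ + y - z)
    regroup = solve-∀
    shift : ∀ k → i + 1ℤ + (+ k - + h) ≡ i + (+ suc k - + h)
    shift k = regroup i (+ k) (+ h)
    top : ∀ x y → x + (y + y + 1ℤ - y) ≡ x + y + 1ℤ
    top = solve-∀
    bottom : ∀ x y → x + (0ℤ - y) ≡ x - y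
    bottom = solve-∀

  tupleSum : ℕ → (ℤ → ℤ) → ℤ → ℤ
  tupleSum m ψ i = sumℤ (map (λ xs → ψ (i + sumℤ xs)) (tuples b m))

  tupleSum-suc : ∀ m ψ i → tupleSum (suc m) ψ i ≡ sumℤ (map (λ d → tupleSum m ψ (i + d)) (digits b))
  tupleSum-suc m ψ i =
    trans (sumℤ-concatMap (λ xs → ψ (i + sumℤ xs)) (λ d → map (d ∷_) (tuples b m)) (digits b))
          (cong sumℤ (map-cong prepend (digits b)))
    where
    prepend : ∀ d → sumℤ (map (λ xs → ψ (i + sumℤ xs)) (map (d ∷_) (tuples b m))) ≡ tupleSum m ψ (i + d)
    prepend d = cong sumℤ (trans (sym (map-∘ (tuples b m)))
                                 (map-cong (λ xs → cong ψ (sym (ℤ.+-assoc i d (sumℤ xs)))) (tuples b m)))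

  tupleSum-cong-bounded : ∀ m ψ χ i → (∀ {s} → Bounded m s → ψ (i + s) ≡ χ (i + s)) →
    tupleSum m ψ i ≡ tupleSum m χ i
  tupleSum-cong-bounded m ψ χ i ψ≡χ = cong sumℤ (map-cong-local (All.map ψ≡χ (tuples-bounded m)))

  tupleSum-zero-bounded : ∀ m ψ i → (∀ {s} → Bounded m s → ψ (i + s) ≡ 0ℤ) → tupleSum m ψ i ≡ 0ℤ
  tupleSum-zero-bounded m ψ i ψ≡0 = sumℤ-map-zero (All.map ψ≡0 (tuples-bounded m))

  tupleSum-Δ : ∀ m ψ i →
    tupleSum (suc m) ψ (i + 1ℤ) - tupleSum (suc m) ψ i ≡ tupleSum m ψ (i + + h + 1ℤ) - tupleSum m ψ (i - + h)
  tupleSum-Δ m ψ i = trans (cong₂ _-_ (tupleSum-suc m ψ (i + 1ℤ)) (tupleSum-suc m ψ i))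
                           (sumℤ-digits-telescope (tupleSum m ψ) i)

  tupleSum-carry-+b : ∀ m (φ : ℤ → ℤ) s →
    tupleSum m (φ ∘ carry) (s + + b) ≡ tupleSum m (λ t → φ (carry t + 1ℤ)) s
  tupleSum-carry-+b m φ s = cong sumℤ (map-cong (λ xs → cong φ (shifted xs)) (tuples b m))
    where
    swap : ∀ x y z → x + y + z ≡ x + z + y
    swap = solve-∀
    shifted : ∀ xs → carry (s + + b + sumℤ xs) ≡ carry (s + sumℤ xs) + 1ℤ
    shifted xs = trans (cong carry (swap s (+ b) (sumℤ xs))) (carry-+b (s + sumℤ xs))

  tupleSum-carry-Δ : ∀ m (φ : ℤ → ℤ) i →
    tupleSum (suc m) (φ ∘ carry) (i + 1ℤ) - tupleSum (suc m) (φ ∘ carry) i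
      ≡ tupleSum m (λ t → φ (carry t + 1ℤ) - φ (carry t)) (i - + h)
  tupleSum-carry-Δ m φ i = begin
    tupleSum (suc m) (φ ∘ carry) (i + 1ℤ) - tupleSum (suc m) (φ ∘ carry) i
      ≡⟨ tupleSum-Δ m (φ ∘ carry) i ⟩
    tupleSum m (φ ∘ carry) (i + + h + 1ℤ) - tupleSum m (φ ∘ carry) (i - + h)
      ≡⟨ cong (λ t → tupleSum m (φ ∘ carry) t - tupleSum m (φ ∘ carry) (i - + h))
              (trans (recentre i (+ h)) (cong (_+_ (i - + h)) (sym b≡h+h+1))) ⟩
    tupleSum m (φ ∘ carry) (i - + h + + b) - tupleSum m (φ ∘ carry) (i - + h)
      ≡⟨ cong (_- tupleSum m (φ ∘ carry) (i - + h)) (tupleSum-carry-+b m φ (i - + h)) ⟩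
    tupleSum m (λ t → φ (carry t + 1ℤ)) (i - + h) - tupleSum m (φ ∘ carry) (i - + h)
      ≡⟨ sym (sumℤ-map-- _ _ (tuples b m)) ⟩
    tupleSum m (λ t → φ (carry t + 1ℤ) - φ (carry t)) (i - + h) ∎
    where
    open ≡-Reasoning
    recentre : ∀ x y → x + y + 1ℤ ≡ x - y + (y + y + 1ℤ)
    recentre = solve-∀

  carry-range : ∀ m w {s} → Bounded (suc m) s →
    w ≤ carry (+ b · w + + h · + m + s) × carry (+ b · w + + h · + m + s) ≤ w + + m
  carry-range m w {s} (s≥ , s≤) = ≤-carry lower , carry-≤ upper
    where
    open ℤ.≤-Reasoning
    i₀ H M : ℤ
    i₀ = + b · w + + h · + m
    H = + h
    M = + m
    low : ∀ b w h m → w · b - h ≡ b · w + h · m + - ((1ℤ + m) · h)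
    low = solve-∀
    high : ∀ w h m → (h + h + 1ℤ) · w + h · m + (1ℤ + m) · h ≡ w · (h + h + 1ℤ) + m · (h + h) + h
    high = solve-∀
    high₂ : ∀ w h m → w · (h + h + 1ℤ) + m · (h + h) + h + m ≡ (w + m) · (h + h + 1ℤ) + h
    high₂ = solve-∀
    lower : w · + b - + h ≤ i₀ + s
    lower = begin
      w · + b - + h                          ≡⟨ low (+ b) w H M ⟩
      i₀ + - ((1ℤ + M) · H)                  ≤⟨ ℤ.+-monoʳ-≤ i₀ s≥ ⟩
      i₀ + s                                 ∎
    upper : i₀ + s ≤ (w + M) · + b + H
    upper = begin
      i₀ + s                                 ≤⟨ ℤ.+-monoʳ-≤ i₀ s≤ ⟩
      + b · w + H · M + (1ℤ + M) · H         ≡⟨ cong (λ x → x · w + H · M + (1ℤ + M) · H) b≡h+h+1 ⟩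
      (H + H + 1ℤ) · w + H · M + (1ℤ + M) · H ≡⟨ high w H M ⟩
      w · (H + H + 1ℤ) + M · (H + H) + H     ≤⟨ ℤ.i≤i+j _ M ⟩
      w · (H + H + 1ℤ) + M · (H + H) + H + M ≡⟨ high₂ w H M ⟩
      (w + M) · (H + H + 1ℤ) + H             ≡⟨ cong (λ x → (w + M) · x + H) (sym b≡h+h+1) ⟩
      (w + M) · + b + H                      ∎

  tupleSum-rising₂ : ∀ m w i →
    tupleSum m (λ s → rising₂ m (+ 2 · (w - carry s))) i ≡ rising₂ m (+ 2 · (+ b · w + + h · + m - + h - i))
  tupleSum-rising₂ zero    w i = refl
  tupleSum-rising₂ (suc m) w = ≗-from-Δ (tupleSum (suc m) (φ ∘ carry)) rhs Δ-agree anchor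
    where
    φ : ℤ → ℤ
    φ k = rising₂ (suc m) (+ 2 · (w - k))
    rhs : ℤ → ℤ
    rhs i = rising₂ (suc m) (+ 2 · (+ b · w + + h · (1ℤ + + m) - + h - i))
    c : ℤ
    c = - (+ 2 · (1ℤ + + m))

    φ-Δ : ∀ k → φ (k + 1ℤ) - φ k ≡ c · rising₂ m (+ 2 · (w - k))
    φ-Δ k = trans (cong (λ x → rising₂ (suc m) x - φ k) (step w k)) (rising₂-Δ m (+ 2 · (w - k)))
      where
      step : ∀ w k → + 2 · (w - (k + 1ℤ)) ≡ + 2 · (w - k) - + 2
      step = solve-∀

    Δ-agree : ∀ i →
      tupleSum (suc m) (φ ∘ carry) (i + 1ℤ) - tupleSum (suc m) (φ ∘ carry) i ≡ rhs (i + 1ℤ) - rhs i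
    Δ-agree i = begin
      tupleSum (suc m) (φ ∘ carry) (i + 1ℤ) - tupleSum (suc m) (φ ∘ carry) i
        ≡⟨ tupleSum-carry-Δ m φ i ⟩
      tupleSum m (λ t → φ (carry t + 1ℤ) - φ (carry t)) (i - + h)
        ≡⟨ cong sumℤ (map-cong (λ xs → φ-Δ (carry (i - + h + sumℤ xs))) (tuples b m)) ⟩
      tupleSum m (λ t → c · rising₂ m (+ 2 · (w - carry t))) (i - + h)
        ≡⟨ sumℤ-map-*ˡ c _ (tuples b m) ⟩
      c · tupleSum m (λ t → rising₂ m (+ 2 · (w - carry t))) (i - + h)
        ≡⟨ cong (c ·_) (tupleSum-rising₂ m w (i - + h)) ⟩
      c · rising₂ m (+ 2 · (+ b · w + + h · + m - + h - (i - + h)))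
        ≡⟨ cong (λ x → c · rising₂ m x) (recentre (+ b) w (+ h) (+ m) i) ⟩
      c · rising₂ m a
        ≡⟨ sym (rising₂-Δ m a) ⟩
      rising₂ (suc m) (a - + 2) - rising₂ (suc m) a
        ≡⟨ cong (λ x → rising₂ (suc m) x - rhs i) (step (+ b) w (+ h) (+ m) i) ⟩
      rhs (i + 1ℤ) - rhs i ∎
      where
      open ≡-Reasoning
      a : ℤ
      a = + 2 · (+ b · w + + h · (1ℤ + + m) - + h - i)
      recentre : ∀ b w h m i → + 2 · (b · w + h · m - h - (i - h)) ≡ + 2 · (b · w + h · (1ℤ + m) - h - i)
      recentre = solve-∀
      step : ∀ b w h m i →
        + 2 · (b · w + h · (1ℤ + m) - h - i) - + 2 ≡ + 2 · (b · w + h · (1ℤ + m) - h - (i + 1ℤ))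
      step = solve-∀

    i₀ : ℤ
    i₀ = + b · w + + h · + m

    anchor : tupleSum (suc m) (φ ∘ carry) i₀ ≡ rhs i₀
    anchor = begin
      tupleSum (suc m) (φ ∘ carry) i₀  ≡⟨ tupleSum-zero-bounded (suc m) (φ ∘ carry) i₀ vanishes ⟩
      0ℤ                               ≡⟨ sym (ℤ.*-zeroˡ (rising₂ m (0ℤ + + 2))) ⟩
      rising₂ (suc m) 0ℤ               ≡⟨ cong (rising₂ (suc m)) (root (+ b) w (+ h) (+ m)) ⟩
      rhs i₀                           ∎
      where
      open ≡-Reasoning
      vanishes : ∀ {s} → Bounded (suc m) s → φ (carry (i₀ + s)) ≡ 0ℤ
      vanishes bs = uncurry (rising₂≡0 m) (carry-range m w bs)
      root : ∀ b w h m → 0ℤ ≡ + 2 · (b · w + h · (1ℤ + m) - h - (b · w + h · m))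
      root = solve-∀

  eval-uPoly-at-b[2W+A] : ∀ A W i →
    eval (uPoly (suc A) i) (+ b · (+ 2 · W + + A)) ≡ rising₂ (suc A) (+ 2 · (+ b · W + + h · + suc A - + h - i))
  eval-uPoly-at-b[2W+A] A W i =
    trans (eval-uPoly (suc A) i (+ b · (+ 2 · W + + A))) (cong (rising₂ (suc A)) (begin
    + b · (+ 2 · W + + A) - + suc A - + 2 · i + 1ℤ
      ≡⟨ cong (λ B → B · (+ 2 · W + + A) - + suc A - + 2 · i + 1ℤ) b≡h+h+1 ⟩
    (+ h + + h + 1ℤ) · (+ 2 · W + + A) - + suc A - + 2 · i + 1ℤ
      ≡⟨ simplify (+ h) W (+ A) i ⟩
    + 2 · ((+ h + + h + 1ℤ) · W + + h · + suc A - + h - i)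
      ≡⟨ cong (λ B → + 2 · (B · W + + h · + suc A - + h - i)) (sym b≡h+h+1) ⟩
    + 2 · (+ b · W + + h · + suc A - + h - i) ∎))
    where
    open ≡-Reasoning
    simplify : ∀ H W A i → (H + H + 1ℤ) · (+ 2 · W + A) - (1ℤ + A) - + 2 · i + 1ℤ
                           ≡ + 2 · ((H + H + 1ℤ) · W + H · (1ℤ + A) - H - i)
    simplify = solve-∀

  tupleSum-coeff-uPoly : ∀ A i e →
    tupleSum (suc A) (λ s → coeff (uPoly (suc A) (carry s)) e) i ≡ + (b ^ e) · coeff (uPoly (suc A) i) e
  tupleSum-coeff-uPoly A i e = begin
    tupleSum n (λ s → coeff (uPoly n (carry s)) e) i ≡⟨ cong sumℤ (map-∘ (tuples b n)) ⟩
    sumℤ (map (λ p → coeff p e) carried)             ≡⟨ sym (coeff-sumP carried e) ⟩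
    coeff (sumP carried) e                           ≡⟨ coeff-≡-of-eval-≡ (sumP carried) dilated y y>w agree e ⟩
    coeff dilated e                                  ≡⟨ coeff-dilate b (uPoly n i) e ⟩
    + (b ^ e) · coeff (uPoly n i) e                  ∎
    where
    open ≡-Reasoning
    n : ℕ
    n = suc A
    carried : List (List ℤ)
    carried = map (λ xs → uPoly n (carry (i + sumℤ xs))) (tuples b n)
    dilated : List ℤ
    dilated = dilate b (uPoly n i)
    y : ℕ → ℕ
    y w = 2 ℕ.* suc w ℕ.+ A
    y>w : ∀ w → w ℕ.< y w
    y>w w = ℕ.≤-trans (ℕ.m≤m+n (suc w) (suc w ℕ.+ 0)) (ℕ.m≤m+n (2 ℕ.* suc w) A)
    agree : ∀ w → eval (sumP carried) (+ y w) ≡ eval dilated (+ y w)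
    agree w = begin
      eval (sumP carried) Y                                       ≡⟨ eval-sumP carried Y ⟩
      sumℤ (map (λ p → eval p Y) carried)                         ≡⟨ cong sumℤ (sym (map-∘ (tuples b n))) ⟩
      tupleSum n (λ s → eval (uPoly n (carry s)) Y) i
        ≡⟨ cong (λ x → tupleSum n (λ s → eval (uPoly n (carry s)) x) i) Y≡2W+A ⟩
      tupleSum n (λ s → eval (uPoly n (carry s)) (+ 2 · W + + A)) i
        ≡⟨ cong sumℤ (map-cong (λ xs → eval-uPoly-at-2W+A A W (carry (i + sumℤ xs))) (tuples b n)) ⟩
      tupleSum n (λ s → rising₂ n (+ 2 · (W - carry s))) i        ≡⟨ tupleSum-rising₂ n W i ⟩
      rising₂ n (+ 2 · (+ b · W + + h · + n - + h - i))           ≡⟨ sym (eval-uPoly-at-b[2W+A] A W i) ⟩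
      eval (uPoly n i) (+ b · (+ 2 · W + + A))                    ≡⟨ cong (λ x → eval (uPoly n i) (+ b · x)) (sym Y≡2W+A) ⟩
      eval (uPoly n i) (+ b · Y)                                  ≡⟨ sym (eval-dilate b (uPoly n i) Y) ⟩
      eval dilated Y                                              ∎
      where
      Y W : ℤ
      Y = + y w
      W = + suc w
      Y≡2W+A : Y ≡ + 2 · W + + A
      Y≡2W+A = trans (ℤ.pos-+ (2 ℕ.* suc w) A) (cong (_+ + A) (ℤ.pos-* 2 (suc w)))

  indicator-inWindow-carry : ∀ s → indicator (inWindow? s (carry s)) ≡ 1ℤ
  indicator-inWindow-carry s with inWindow? s (carry s)
  ... | yes _  = refl
  ... | no ¬in = ⊥-elim (¬in (carry-inWindow s))

  indicator-inWindow-≢ : ∀ {s k} → k ≢ carry s → indicator (inWindow? s k) ≡ 0ℤ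
  indicator-inWindow-≢ {s} {k} k≢c with inWindow? s k
  ... | yes k-in = ⊥-elim (k≢c (carry-unique k-in))
  ... | no _   = refl

  sumℤ-states-indicator : ∀ n q (g : ℤ → ℤ) s → n ≡ q ℕ.+ q → - + q ≤ carry s × carry s ≤ + q →
    sumℤ (map (λ k → indicator (inWindow? s k) · g k) (map (λ t → + t - + q) (upTo (suc n)))) ≡ g (carry s)
  sumℤ-states-indicator n q g s n≡q+q (lo , hi) = begin
    sumℤ (map (λ k → indicator (inWindow? s k) · g k) (map state (upTo (suc n))))
      ≡⟨ cong sumℤ (sym (map-∘ {g = λ k → indicator (inWindow? s k) · g k} {f = state} (upTo (suc n)))) ⟩
    sumℤ (map F (upTo (suc n)))
      ≡⟨ sumℤ-upTo-single F (suc n) t₀<1+n others ⟩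
    F t₀
      ≡⟨ cong (λ k → indicator (inWindow? s k) · g k) state-t₀ ⟩
    indicator (inWindow? s (carry s)) · g (carry s)
      ≡⟨ cong (_· g (carry s)) (indicator-inWindow-carry s) ⟩
    1ℤ · g (carry s)
      ≡⟨ ℤ.*-identityˡ (g (carry s)) ⟩
    g (carry s) ∎
    where
    open ≡-Reasoning
    state : ℕ → ℤ
    state t = + t - + q
    F : ℕ → ℤ
    F t = indicator (inWindow? s (state t)) · g (state t)
    t₀ : ℕ
    t₀ = ∣ carry s + + q ∣
    +t₀ : + t₀ ≡ carry s + + q
    +t₀ = ℤ.0≤i⇒+∣i∣≡i (ℤ.≤-trans (ℤ.≤-reflexive (sym (ℤ.+-inverseˡ (+ q)))) (ℤ.+-monoˡ-≤ (+ q) lo))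
    cancel : ∀ x y → x + y - y ≡ x
    cancel = solve-∀
    state-t₀ : state t₀ ≡ carry s
    state-t₀ = trans (cong (_- + q) +t₀) (cancel (carry s) (+ q))
    t₀<1+n : t₀ ℕ.< suc n
    t₀<1+n = ℕ.s≤s (ℤ.drop‿+≤+ (ℤ.≤-trans (ℤ.≤-reflexive +t₀) (ℤ.≤-trans (ℤ.+-monoˡ-≤ (+ q) hi) (ℤ.≤-reflexive q+q≡n))))
      where
      q+q≡n : + q + + q ≡ + n
      q+q≡n = trans (sym (ℤ.pos-+ q q)) (cong +_ (sym n≡q+q))
    others : ∀ {t} → t ℕ.< suc n → t ≢ t₀ → F t ≡ 0ℤ
    others {t} _ t≢t₀ =
      trans (cong (_· g (state t)) (indicator-inWindow-≢ state-t≢carry)) (ℤ.*-zeroˡ (g (state t)))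
      where
      state-t≢carry : state t ≢ carry s
      state-t≢carry eq =
        t≢t₀ (ℤ.+-injective (trans (sym (cancel′ (+ t) (+ q))) (trans (cong (_+ + q) eq) (sym +t₀))))
        where
        cancel′ : ∀ x y → x - y + y ≡ x
        cancel′ = solve-∀

  carry-bounded : ∀ q {i s} → - + q ≤ i → i ≤ + q → Bounded (q ℕ.+ q) s →
    - + q ≤ carry (i + s) × carry (i + s) ≤ + q
  carry-bounded q {i} {s} i≥ i≤ (s≥ , s≤) = ≤-carry lower , carry-≤ upper
    where
    open ℤ.≤-Reasoning
    Q H : ℤ
    Q = + q
    H = + h
    Q+Q : + (q ℕ.+ q) ≡ Q + Q
    Q+Q = ℤ.pos-+ q q
    lower-eq : ∀ Q H → - Q · (H + H + 1ℤ) ≡ - Q + - ((Q + Q) · H)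
    lower-eq = solve-∀
    upper-eq : ∀ Q H → Q + (Q + Q) · H ≡ Q · (H + H + 1ℤ)
    upper-eq = solve-∀
    lower : - Q · + b - H ≤ i + s
    lower = begin
      - Q · + b - H                  ≤⟨ ℤ.i-j≤i (- Q · + b) H ⟩
      - Q · + b                      ≡⟨ cong (_·_ (- Q)) b≡h+h+1 ⟩
      - Q · (H + H + 1ℤ)             ≡⟨ lower-eq Q H ⟩
      - Q + - ((Q + Q) · H)          ≡⟨ cong (λ t → - Q + - (t · H)) (sym Q+Q) ⟩
      - Q + - (+ (q ℕ.+ q) · H)      ≤⟨ ℤ.+-mono-≤ i≥ s≥ ⟩
      i + s                          ∎
    upper : i + s ≤ Q · + b + H
    upper = begin
      i + s                          ≤⟨ ℤ.+-mono-≤ i≤ s≤ ⟩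
      Q + + (q ℕ.+ q) · H            ≡⟨ cong (λ t → Q + t · H) Q+Q ⟩
      Q + (Q + Q) · H                ≡⟨ upper-eq Q H ⟩
      Q · (H + H + 1ℤ)               ≡⟨ cong (_·_ Q) (sym b≡h+h+1) ⟩
      Q · + b                        ≤⟨ ℤ.i≤i+j (Q · + b) H ⟩
      Q · + b + H                    ∎

  sumℤ-count-u : ∀ A q j i → suc A ≡ q ℕ.+ q → - + q ≤ i → i ≤ + q →
    sumℤ (map (λ k → + length (filter (λ xs → carryOut? b i xs k) (tuples b (suc A))) · u (suc A) j k)
              (map (λ t → + t - + q) (upTo (suc (suc A)))))
      ≡ + (b ^ (suc A ∸ j)) · u (suc A) j i
  sumℤ-count-u A q j i n≡q+q i≥ i≤ = begin
    sumℤ (map (λ k → + length (filter (λ xs → carryOut? b i xs k) T) · g k) states′)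
      ≡⟨ cong sumℤ (map-cong count-as-sum states′) ⟩
    sumℤ (map (λ k → sumℤ (map (λ xs → indicator (carryOut? b i xs k) · g k) T)) states′)
      ≡⟨ sumℤ-swap (λ k xs → indicator (carryOut? b i xs k) · g k) states′ T ⟩
    tupleSum n ψ i
      ≡⟨ tupleSum-cong-bounded n ψ (g ∘ carry) i ψ≡g∘carry ⟩
    tupleSum n (g ∘ carry) i
      ≡⟨ tupleSum-coeff-uPoly A i (n ∸ j) ⟩
    + (b ^ (n ∸ j)) · u n j i ∎
    where
    open ≡-Reasoning
    n : ℕ
    n = suc A
    T : List (List ℤ)
    T = tuples b n
    g : ℤ → ℤ
    g = u n j
    states′ : List ℤ
    states′ = map (λ t → + t - + q) (upTo (suc n))
    ψ : ℤ → ℤ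
    ψ s = sumℤ (map (λ k → indicator (inWindow? s k) · g k) states′)
    count-as-sum : ∀ k → + length (filter (λ xs → carryOut? b i xs k) T) · g k
                         ≡ sumℤ (map (λ xs → indicator (carryOut? b i xs k) · g k) T)
    count-as-sum k = trans (cong (_· g k) (length-filter (λ xs → carryOut? b i xs k) T))
                           (sym (sumℤ-map-*ʳ (g k) (λ xs → indicator (carryOut? b i xs k)) T))
    ψ≡g∘carry : ∀ {s} → Bounded n s → ψ (i + s) ≡ g (carry (i + s))
    ψ≡g∘carry {s} bs =
      sumℤ-states-indicator n q g (i + s) n≡q+q (carry-bounded q i≥ i≤ (subst (λ m → Bounded m s) n≡q+q bs))

b≡1+2·halfDigit : ∀ b → b % 2 ≡ 1 → b ≡ suc (2 ℕ.* halfDigit b)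
b≡1+2·halfDigit b b%2≡1 = begin
  b                              ≡⟨ ℕ.m≡m%n+[m/n]*n b 2 ⟩
  b % 2 ℕ.+ b / 2 ℕ.* 2          ≡⟨ cong₂ ℕ._+_ b%2≡1 (ℕ.*-comm (b / 2) 2) ⟩
  suc (2 ℕ.* halfDigit b)        ∎
  where open ≡-Reasoning

theorem4p1 : (b n : ℕ) → b % 2 ≡ 1 → 3 Data.Nat.≤ b → 2 ∣ n → 1 Data.Nat.≤ n →
    (j : ℕ) → j Data.Nat.≤ n →
    (i : ℤ) → - (+ (n / 2)) ≤ i → i ≤ + (n / 2) →
    sumℚ (map (λ k → K b n i k * (u n j k /ℕ 1)) (states n)) ≡ ((+ 1) /ℕ (b ^ j)) * (u n j i /ℕ 1)
theorem4p1 b n@(suc A) b%2≡1 _ 2∣n _ j j≤n i i≥ i≤ = begin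
  sumℚ (map (λ k → K b n i k * (u n j k /ℕ 1)) (states n))
    ≡⟨ sumℚ-/ℕ (b ^ n) count (u n j) (states n) ⟩
  sumℤ (map (λ k → count k · u n j k) (states n)) /ℕ (b ^ n)
    ≡⟨ cong (_/ℕ (b ^ n)) (sumℤ-count-u A (n / 2) j i n≡q+q i≥ i≤) ⟩
  (+ (b ^ (n ∸ j)) · u n j i) /ℕ (b ^ n)
    ≡⟨ ·/ℕ-cancelˡ (b ^ (n ∸ j)) (b ^ j) (b ^ n) (u n j i) b^n≡b^[n∸j]*b^j ⟩
  (1ℤ /ℕ (b ^ j)) * (u n j i /ℕ 1) ∎
  where
  open ≡-Reasoning
  open BalancedCarries b (b≡1+2·halfDigit b b%2≡1)
  instance
    b^n-nonZero : ℕ.NonZero (b ^ n)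
    b^n-nonZero = ℕ.m^n≢0 b n
    b^j-nonZero : ℕ.NonZero (b ^ j)
    b^j-nonZero = ℕ.m^n≢0 b j
  count : ℤ → ℤ
  count k = + length (filter (λ xs → carryOut? b i xs k) (tuples b n))
  n≡q+q : n ≡ n / 2 ℕ.+ n / 2
  n≡q+q = trans (sym (ℕ.m*[n/m]≡n 2∣n)) (cong (n / 2 ℕ.+_) (ℕ.+-identityʳ (n / 2)))
  b^n≡b^[n∸j]*b^j : b ^ n ≡ b ^ (n ∸ j) ℕ.* b ^ j
  b^n≡b^[n∸j]*b^j = trans (cong (b ^_) (sym (ℕ.m∸n+n≡m j≤n))) (ℕ.^-distribˡ-+-* b (n ∸ j) j)
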